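{- Let $\mathrm{H}$ be a reflexive tournament and $\mathrm{H}_0$ a subtournament of $\mathrm{H}$ with $m$ vertices having a directed Hamilton cycle $\mathrm{HC}_0$. If $\mathrm{H}$ retracts to $\mathrm{H}_0$, then $\mathrm{Spill}_m(\mathrm{H}[\mathrm{H}_0,\mathrm{HC}_0])=V(\mathrm{H})$.
   Context: A reflexive tournament is a digraph with more than one vertex, a loop at every vertex, and exactly one of $(u,v),(v,u)$ as an edge for every two distinct vertices $u,v$; a subtournament is an induced subgraph that is a tournament. $\mathrm{H}$ retracts to an induced subgraph $\mathrm{H}_0$ if there is a homomorphism $r:\mathrm{H}\to\mathrm{H}_0$ (vertex map sending edges to edges) with $r(v)=v$ for all $v\in V(\mathrm{H}_0)$. A directed Hamilton cycle $\mathrm{HC}_0$ of $\mathrm{H}_0$ is an enumeration $v_1,\dots,v_m$ of $V(\mathrm{H}_0)$ with $(v_i,v_{i+1})\in E$ for all $i$ (indices mod $m$). $\mathrm{Cyl}_m$ has vertices $(i,j)$, $i,j\in\{1,\dots,m\}$, a loop at every vertex, edges $((i,j),(i+1,j))$, and for $1\le j<m$ edges $((i,j),(i,j+1))$ and $((i,j+1),(i+1,j))$ (first indices mod $m$); copy $j=1$ is the bottom copy, copy $j=m$ the top copy. $\mathrm{F}(\mathrm{H}_0,\mathrm{HC}_0)$ is obtained from the disjoint union of $\mathrm{H}$ and $\mathrm{Cyl}_m$ by identifying $(i,1)$ with $v_i$ for each $i$. A retraction of $\mathrm{F}(\mathrm{H}_0,\mathrm{HC}_0)$ to $\mathrm{H}$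 is a homomorphism to $\mathrm{H}$ that is the identity on $V(\mathrm{H})$. $\mathrm{Spill}_m(\mathrm{H}[\mathrm{H}_0,\mathrm{HC}_0])$ is the set of $y\in V(\mathrm{H})$ for which there exist such a retraction $r$ and a vertex $x$ of the top copy of $\mathrm{Cyl}_m$ with $r(x)=y$. -}

module Defs where

open import Data.Nat using (ℕ; zero; suc; _≤_; _%_)
open import Data.Nat.DivMod using (m%n<n)
open import Data.Fin using (Fin; toℕ; fromℕ<; fromℕ; inject₁) renaming (zero to fzero; suc to fsuc)
open import Data.Product using (Σ; _×_; _,_; ∃; proj₁)
open import Data.Sum using (_⊎_)
open import Relation.Nullary using (¬_)
open import Relation.Binary.PropositionalEquality using (_≡_; _≢_)
open import Function.Definitions using (Injective)

record Digraph : Set₁ where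
  field
    size : ℕ
    E    : Fin size → Fin size → Set

open Digraph public

record IsReflexiveTournament (H : Digraph) : Set where
  field
    moreThanOne : 2 ≤ size H
    loops       : ∀ u → E H u u
    tourn       : ∀ u v → u ≢ v →
                  (E H u v × ¬ E H v u) ⊎ (E H v u × ¬ E H u v)

nextMod : ∀ {k} → Fin (suc k) → Fin (suc k)
nextMod {k} i = fromℕ< (m%n<n (suc (toℕ i)) (suc k))

-- A vertex v ∈ V(H0), where V(H0) is the image of the enumeration vs.
InImage : ∀ {n m} → (Fin m → Fin n) → Fin n → Set
InImage vs x = ∃ λ i → vs i ≡ x

IsHamiltonCycle : ∀ {k} (H : Digraph) → (Fin (suc k) → Fin (size H)) → Set
IsHamiltonCycle H vs = Injective _≡_ _≡_ vs × (∀ i → E H (vs i) (vs (nextMod i)))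

RetractsTo : ∀ {m} (H : Digraph) → (Fin m → Fin (size H)) → Set
RetractsTo H vs =
  Σ (Fin (size H) → Fin (size H)) λ r →
      (∀ x → InImage vs (r x))
    × (∀ x y → E H x y → E H (r x) (r y))
    × (∀ x → InImage vs x → r x ≡ x)

-- The cylinder Cyl_m, m = suc k.  Vertex (i , j): i the position in the
-- cycle, j the copy (fzero = copy 1 = bottom, fromℕ k = copy m = top).
data CylEdge (k : ℕ) : Fin (suc k) × Fin (suc k) → Fin (suc k) × Fin (suc k) → Set where
  loop  : ∀ i j → CylEdge k (i , j) (i , j)
  horiz : ∀ i j → CylEdge k (i , j) (nextMod i , j)
  up    : ∀ i (j : Fin k) → CylEdge k (i , inject₁ j) (i , fsuc j)
  diag  : ∀ i (j : Fin k) → CylEdge k (i , fsuc j) (nextMod i , inject₁ j)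

-- F is the union of H and Cyl_m with
-- (i,1) identified with v_i; a homomorphism F → H that is the identity on H
-- is exactly a map c on the cylinder vertices that agrees with vs on the
-- bottom copy and preserves all cylinder edges (H-edges are preserved by the
-- identity automatically).
RetractionF : ∀ {k} (H : Digraph) → (Fin (suc k) → Fin (size H)) → Set
RetractionF {k} H vs =
  Σ (Fin (suc k) × Fin (suc k) → Fin (size H)) λ c →
      (∀ i → c (i , fzero) ≡ vs i)
    × (∀ x y → CylEdge k x y → E H (c x) (c y))

InSpill : ∀ {k} (H : Digraph) → (Fin (suc k) → Fin (size H)) → Fin (size H) → Set
InSpill {k} H vs y =
  Σ (RetractionF H vs) λ rc → ∃ λ i → proj₁ rc (i , fromℕ k) ≡ y

-- Let r retract H onto H₀ and let v_q = r(y).  An edge between y and a cycle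
-- vertex v_j ≠ v_q is carried by r to one between v_q and v_j, so in the
-- tournament H₀ the cycle neighbours of v_q force v_{q-1} → y → v_{q+1}.
-- Hence replacing v_q by y in HC₀ still gives a closed walk, and this walk
-- (shifted by one step when y → v_q) fits above HC₀ as the top copy of the
-- cylinder.
module Submission where

open import Defs
open import Data.Nat using (ℕ; suc; _≤_; z≤n; s≤s; _%_)
open import Data.Nat.Properties using (1+n≢n)
open import Data.Nat.DivMod using (m<n⇒m%n≡m; n%n≡0)
open import Data.Fin using (Fin; toℕ; fromℕ; inject₁; _≟_) renaming (zero to fzero; suc to fsuc)
open import Data.Fin.Properties using (toℕ-fromℕ<; toℕ-fromℕ; toℕ-inject₁; toℕ<n; toℕ-injective; fromℕ≢inject₁)
open import Data.Fin.Relation.Unary.Top using (view; ‵fromℕ; ‵inject₁)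
open import Data.Product using (_×_; _,_; proj₁; proj₂)
open import Data.Sum using (_⊎_; inj₁; inj₂)
open import Data.Empty using (⊥-elim)
open import Function using (_∘_)
open import Relation.Nullary using (¬_; yes; no)
open import Relation.Binary.PropositionalEquality

toℕ-nextMod : ∀ {k} (i : Fin (suc k)) → toℕ (nextMod i) ≡ suc (toℕ i) % suc k
toℕ-nextMod i = toℕ-fromℕ< _

nextMod-fromℕ : ∀ k → nextMod (fromℕ k) ≡ fzero
nextMod-fromℕ k = toℕ-injective (begin
  toℕ (nextMod (fromℕ k))      ≡⟨ toℕ-nextMod (fromℕ k) ⟩
  suc (toℕ (fromℕ k)) % suc k  ≡⟨ cong (λ n → suc n % suc k) (toℕ-fromℕ k) ⟩
  suc k % suc k                ≡⟨ n%n≡0 (suc k) ⟩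
  0                            ∎)
  where open ≡-Reasoning

nextMod-inject₁ : ∀ {k} (j : Fin k) → nextMod (inject₁ j) ≡ fsuc j
nextMod-inject₁ {k} j = toℕ-injective (begin
  toℕ (nextMod (inject₁ j))      ≡⟨ toℕ-nextMod (inject₁ j) ⟩
  suc (toℕ (inject₁ j)) % suc k  ≡⟨ cong (λ n → suc n % suc k) (toℕ-inject₁ j) ⟩
  suc (toℕ j) % suc k            ≡⟨ m<n⇒m%n≡m (s≤s (toℕ<n j)) ⟩
  suc (toℕ j)                    ∎)
  where open ≡-Reasoning

nextMod-≢ : ∀ {k} (i : Fin (suc (suc k))) → nextMod i ≢ i
nextMod-≢ {k} i with view i
... | ‵fromℕ rewrite nextMod-fromℕ (suc k) = λ ()
... | ‵inject₁ j rewrite nextMod-inject₁ j = λ eq → 1+n≢n (trans (cong toℕ eq) (toℕ-inject₁ j))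

prevMod : ∀ {k} → Fin (suc k) → Fin (suc k)
prevMod {k} fzero = fromℕ k
prevMod (fsuc j)  = inject₁ j

nextMod-prevMod : ∀ {k} (i : Fin (suc k)) → nextMod (prevMod i) ≡ i
nextMod-prevMod {k} fzero = nextMod-fromℕ k
nextMod-prevMod (fsuc j)  = nextMod-inject₁ j

ClosedWalk : ∀ {k} (H : Digraph) → (Fin (suc k) → Fin (size H)) → Set
ClosedWalk H w = ∀ i → E H (w i) (w (nextMod i))

module _ {H : Digraph} (RT : IsReflexiveTournament H) where
  open IsReflexiveTournament RT

  tournament-total : ∀ u v → E H u v ⊎ E H v u
  tournament-total u v with u ≟ v
  ... | yes refl = inj₁ (loops u)
  ... | no u≢v with tourn u v u≢v
  ...   | inj₁ (uv , _) = inj₁ uv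
  ...   | inj₂ (vu , _) = inj₂ vu

  tournament-asym : ∀ {u v} → u ≢ v → E H u v → ¬ E H v u
  tournament-asym u≢v uv vu with tourn _ _ u≢v
  ... | inj₁ (_ , ¬vu) = ¬vu vu
  ... | inj₂ (_ , ¬uv) = ¬uv uv

-- All copies of Cyl_m below the top one are sent onto HC₀ itself, so the
-- vertical and diagonal edges ask exactly for v_i → T i → v_{i+1}.
module _ (H : Digraph) (loops : ∀ u → E H u u) {k : ℕ}
         {vs : Fin (suc (suc k)) → Fin (size H)} (vs-walk : ClosedWalk H vs) where

  inSpill-viaTopWalk : (T : Fin (suc (suc k)) → Fin (size H)) → ClosedWalk H T →
                       (∀ i → E H (vs i) (T i)) → (∀ i → E H (T i) (vs (nextMod i))) →
                       ∀ i₀ {y} → T i₀ ≡ y → InSpill H vs y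
  inSpill-viaTopWalk T T-walk rises falls i₀ {y} Ti₀≡y = (cyl , bottom , edges) , i₀ , top-i₀
    where
    top : Fin (suc (suc k))
    top = fromℕ (suc k)

    cyl : Fin (suc (suc k)) × Fin (suc (suc k)) → Fin (size H)
    cyl (i , j) with j ≟ top
    ... | yes _ = T i
    ... | no _  = vs i

    bottom : ∀ i → cyl (i , fzero) ≡ vs i
    bottom i with fzero ≟ top
    ... | no _ = refl

    edges : ∀ x z → CylEdge (suc k) x z → E H (cyl x) (cyl z)
    edges _ _ (loop i j) = loops _
    edges _ _ (horiz i j) with j ≟ top
    ... | yes _ = T-walk i
    ... | no _  = vs-walk i
    edges _ _ (up i j) with inject₁ j ≟ top | fsuc j ≟ top
    ... | yes j≡top | _     = ⊥-elim (fromℕ≢inject₁ (sym j≡top))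
    ... | no _      | yes _ = rises i
    ... | no _      | no _  = loops _
    edges _ _ (diag i j) with fsuc j ≟ top | inject₁ j ≟ top
    ... | _     | yes j≡top = ⊥-elim (fromℕ≢inject₁ (sym j≡top))
    ... | yes _ | no _      = falls i
    ... | no _  | no _      = vs-walk i

    top-i₀ : cyl (i₀ , top) ≡ y
    top-i₀ with top ≟ top
    ... | yes _      = Ti₀≡y
    ... | no top≢top = ⊥-elim (top≢top refl)

module Detour (H : Digraph) (RT : IsReflexiveTournament H) {k : ℕ}
              (vs : Fin (suc (suc k)) → Fin (size H)) (hc : IsHamiltonCycle H vs)
              (rt : RetractsTo H vs) (y : Fin (size H)) where
  open IsReflexiveTournament RT using (loops)

  vs-injective : ∀ {i j} → vs i ≡ vs j → i ≡ j
  vs-injective = proj₁ hc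

  vs-walk : ClosedWalk H vs
  vs-walk = proj₂ hc

  r : Fin (size H) → Fin (size H)
  r = proj₁ rt

  r-hom : ∀ x z → E H x z → E H (r x) (r z)
  r-hom = proj₁ (proj₂ (proj₂ rt))

  r-fixes-vs : ∀ i → r (vs i) ≡ vs i
  r-fixes-vs i = proj₂ (proj₂ (proj₂ rt)) (vs i) (i , refl)

  q : Fin (suc (suc k))
  q = proj₁ (proj₁ (proj₂ rt) y)

  vs-q≡r-y : vs q ≡ r y
  vs-q≡r-y = proj₂ (proj₁ (proj₂ rt) y)

  retract-out : ∀ {j} → E H y (vs j) → E H (vs q) (vs j)
  retract-out e = subst₂ (E H) (sym vs-q≡r-y) (r-fixes-vs _) (r-hom _ _ e)

  retract-in : ∀ {j} → E H (vs j) y → E H (vs j) (vs q)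
  retract-in e = subst₂ (E H) (r-fixes-vs _) (sym vs-q≡r-y) (r-hom _ _ e)

  predecessor→y : ∀ {j} → nextMod j ≡ q → E H (vs j) y
  predecessor→y {j} j+1≡q with tournament-total RT (vs j) y
  ... | inj₁ j→y = j→y
  ... | inj₂ y→j = ⊥-elim (tournament-asym RT vs-j≢vs-q j→q (retract-out y→j))
    where
    vs-j≢vs-q : vs j ≢ vs q
    vs-j≢vs-q eq = nextMod-≢ j (trans j+1≡q (sym (vs-injective eq)))
    j→q : E H (vs j) (vs q)
    j→q = subst (E H (vs j) ∘ vs) j+1≡q (vs-walk j)

  y→successor : E H y (vs (nextMod q))
  y→successor with tournament-total RT y (vs (nextMod q))
  ... | inj₁ y→q+1 = y→q+1
  ... | inj₂ q+1→y = ⊥-elim (tournament-asym RT vs-q≢vs-q+1 (vs-walk q) (retract-in q+1→y))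
    where
    vs-q≢vs-q+1 : vs q ≢ vs (nextMod q)
    vs-q≢vs-q+1 eq = nextMod-≢ q (sym (vs-injective eq))

  detour : Fin (suc (suc k)) → Fin (size H)
  detour i with i ≟ q
  ... | yes _ = y
  ... | no _  = vs i

  detour-q : detour q ≡ y
  detour-q with q ≟ q
  ... | yes _  = refl
  ... | no q≢q = ⊥-elim (q≢q refl)

  detour-walk : ClosedWalk H detour
  detour-walk i with i ≟ q | nextMod i ≟ q
  ... | yes i≡q | yes i+1≡q = ⊥-elim (nextMod-≢ i (trans i+1≡q (sym i≡q)))
  ... | yes refl | no _     = y→successor
  ... | no _    | yes i+1≡q = predecessor→y i+1≡q
  ... | no _    | no _      = vs-walk i

  inSpill-if-vs-q→y : E H (vs q) y → InSpill H vs y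
  inSpill-if-vs-q→y q→y = inSpill-viaTopWalk H loops vs-walk detour detour-walk rises falls q detour-q
    where
    rises : ∀ i → E H (vs i) (detour i)
    rises i with i ≟ q
    ... | yes refl = q→y
    ... | no _     = loops (vs i)
    falls : ∀ i → E H (detour i) (vs (nextMod i))
    falls i with i ≟ q
    ... | yes refl = y→successor
    ... | no _     = vs-walk i

  inSpill-if-y→vs-q : E H y (vs q) → InSpill H vs y
  inSpill-if-y→vs-q y→q =
    inSpill-viaTopWalk H loops vs-walk (detour ∘ nextMod) (detour-walk ∘ nextMod) rises falls
      (prevMod q) (trans (cong detour (nextMod-prevMod q)) detour-q)
    where
    rises : ∀ i → E H (vs i) (detour (nextMod i))
    rises i with nextMod i ≟ q
    ... | yes i+1≡q = predecessor→y i+1≡q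
    ... | no _      = vs-walk i
    falls : ∀ i → E H (detour (nextMod i)) (vs (nextMod i))
    falls i with nextMod i ≟ q
    ... | yes i+1≡q = subst (E H y ∘ vs) (sym i+1≡q) y→q
    ... | no _      = loops _

  inSpill : InSpill H vs y
  inSpill with tournament-total RT (vs q) y
  ... | inj₁ q→y = inSpill-if-vs-q→y q→y
  ... | inj₂ y→q = inSpill-if-y→vs-q y→q

lemma15 : (H : Digraph) → IsReflexiveTournament H →
          (k : ℕ) → 1 ≤ k → (vs : Fin (suc k) → Fin (size H)) →
          IsHamiltonCycle H vs → RetractsTo H vs →
          (y : Fin (size H)) → InSpill H vs y
lemma15 H RT (suc k) (s≤s z≤n) vs hc rt y = Detour.inSpill H RT vs hc rt y
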